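{- Let $v_1v_2v_3v_4$ be a path of length three, and let $f:\{v_1,v_4\}\to[5]^2$ with $f(v_1)\cap f(v_4)\neq\emptyset$. If $a,b$ are distinct elements of $\{1,2,3,4,5\}\setminus f(v_1)$, then $f$ can be extended to a map $\{v_1,v_2,v_3,v_4\}\to[5]^2$ such that $v_2$ and $v_3$ are satisfied (in the path) and $f(v_2)=\{a,b\}$.
   Context: $[5]^2$ denotes the set of $2$-element subsets of $\{1,2,3,4,5\}$. For a graph $G$, a map $f:V(G)\to[5]^2$ and a vertex $v$, $v$ is satisfied (with respect to $f$) if $\bigcup_{u\in N[v]} f(u)=\{1,2,3,4,5\}$, where $N[v]$ is the closed neighborhood of $v$. -}

module Defs where

open import Data.Bool using (Bool; true; false; _∨_)
open import Data.Nat using (ℕ; suc; zero)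
open import Data.Fin using (Fin; toℕ; _≟_)
open import Data.Fin.Subset using (Subset; ∣_∣; ⋃; ⊤)
open import Data.List using (List; filter; map; allFin)
open import Data.Product using (Σ; proj₁)
open import Relation.Binary.PropositionalEquality using (_≡_)
open import Relation.Nullary.Decidable using (⌊_⌋; yes; no)
open import Relation.Nullary using (Dec)
open import Data.Bool using (T?)

-- [5]^2 : the 2-element subsets of {1,...,5} (colours encoded as Fin 5)
Pair5 : Set
Pair5 = Σ (Subset 5) (λ s → ∣ s ∣ ≡ 2)

record Graph (n : ℕ) : Set where
  field
    adj : Fin n → Fin n → Bool
open Graph public

closedNbhd : ∀ {n} → Graph n → Fin n → List (Fin n)
closedNbhd {n} G v = filter (λ u → T? (isN u)) (allFin n)
  where
  isN : Fin n → Bool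
  isN u = ⌊ u ≟ v ⌋ ∨ adj G v u ∨ adj G u v

Satisfied : ∀ {n} → Graph n → (Fin n → Pair5) → Fin n → Set
Satisfied G f v = ⋃ (map (λ u → proj₁ (f u)) (closedNbhd G v)) ≡ ⊤

∣-∣ : ℕ → ℕ → ℕ
∣-∣ zero n = n
∣-∣ (suc m) zero = suc m
∣-∣ (suc m) (suc n) = ∣-∣ m n

-- the path v1 v2 v3 v4 on vertex set Fin 4 (vertex i ↔ v_{i+1}),
-- with v_i ~ v_j iff |i - j| = 1
P4 : Graph 4
P4 = record { adj = λ i j → ⌊ Data.Nat._≟_ (∣-∣ (toℕ i) (toℕ j)) 1 ⌋ }
  where import Data.Nat

-- Let c be a colour shared by f(v₁) and f(v₄); c ∉ {a, b} since a, b ∉ f(v₁).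
-- Put f(v₃) = ∁ {a, b, c}, which has 5 − 3 = 2 elements. Every set
-- containing c covers {a, b, c} together with {a, b}, so f(v₂) ∪ f(v₃)
-- joined with f(v₁) or with f(v₄) is all of [5]: v₂ and v₃ are satisfied.
module Submission where

open import Defs
open import Data.Fin using (Fin; zero; suc)
open import Data.Fin.Subset
  using (Subset; inside; outside; _∩_; _∪_; ∁; ⁅_⁆; ⊤; ∣_∣; _∈_; _∉_; _⊆_; Nonempty)
open import Data.Fin.Subset.Properties
  using ( _∈?_; ⊆⊤; ⊆-antisym; x∈p∪q⁺; x∈p∪q⁻; x∈p∩q⁻; x∉p⇒x∈∁p; ∪-assoc; ∪-comm
        ; x∈⁅y⁆⇒x≡y; x≢y⇒x∉⁅y⁆; ∣⁅x⁆∣≡1; ∣∁p∣≡n∸∣p∣; ∪-identityʳ)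
open import Data.Nat using (suc; _∸_)
open import Data.Product using (Σ; _×_; _,_; proj₁; proj₂)
open import Data.Sum using (inj₁; inj₂)
open import Data.Vec using (_∷_; here; there)
open import Data.Empty using (⊥-elim)
open import Function using (_∘_)
open import Relation.Binary.PropositionalEquality
  using (_≡_; _≢_; refl; sym; trans; cong; subst; module ≡-Reasoning)
open import Relation.Nullary using (yes; no)

∣p∪⁅x⁆∣≡1+∣p∣ : ∀ {n} {p : Subset n} {x : Fin n} → x ∉ p → ∣ p ∪ ⁅ x ⁆ ∣ ≡ suc ∣ p ∣
∣p∪⁅x⁆∣≡1+∣p∣ {p = inside  ∷ p} {zero}  x∉p = ⊥-elim (x∉p here)
∣p∪⁅x⁆∣≡1+∣p∣ {p = outside ∷ p} {zero}  x∉p = cong (suc ∘ ∣_∣) (∪-identityʳ p)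
∣p∪⁅x⁆∣≡1+∣p∣ {p = inside  ∷ p} {suc x} x∉p = cong suc (∣p∪⁅x⁆∣≡1+∣p∣ (x∉p ∘ there))
∣p∪⁅x⁆∣≡1+∣p∣ {p = outside ∷ p} {suc x} x∉p = ∣p∪⁅x⁆∣≡1+∣p∣ (x∉p ∘ there)

∣⁅x⁆∪⁅y⁆∣≡2 : ∀ {n} {x y : Fin n} → x ≢ y → ∣ ⁅ x ⁆ ∪ ⁅ y ⁆ ∣ ≡ 2
∣⁅x⁆∪⁅y⁆∣≡2 {x = x} x≢y = trans (∣p∪⁅x⁆∣≡1+∣p∣ (x≢y⇒x∉⁅y⁆ (x≢y ∘ sym))) (cong suc (∣⁅x⁆∣≡1 x))

x∈p⇒x∉⁅y⁆∪⁅z⁆ : ∀ {n} {p : Subset n} {x y z : Fin n} →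
                 x ∈ p → y ∉ p → z ∉ p → x ∉ ⁅ y ⁆ ∪ ⁅ z ⁆
x∈p⇒x∉⁅y⁆∪⁅z⁆ {y = y} {z} x∈p y∉p z∉p x∈⁅y,z⁆ with x∈p∪q⁻ ⁅ y ⁆ ⁅ z ⁆ x∈⁅y,z⁆
... | inj₁ x∈⁅y⁆ = y∉p (subst (_∈ _) (x∈⁅y⁆⇒x≡y y x∈⁅y⁆) x∈p)
... | inj₂ x∈⁅z⁆ = z∉p (subst (_∈ _) (x∈⁅y⁆⇒x≡y z x∈⁅z⁆) x∈p)

p∪∁q≡⊤ : ∀ {n} {p q : Subset n} → q ⊆ p → p ∪ ∁ q ≡ ⊤
p∪∁q≡⊤ {p = p} {q} q⊆p = ⊆-antisym ⊆⊤ ⊤⊆p∪∁q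
  where
  ⊤⊆p∪∁q : ⊤ ⊆ p ∪ ∁ q
  ⊤⊆p∪∁q {x} _ with x ∈? q
  ... | yes x∈q = x∈p∪q⁺ (inj₁ (q⊆p x∈q))
  ... | no  x∉q = x∈p∪q⁺ (inj₂ (x∉p⇒x∈∁p x∉q))

q∪⁅x⁆⊆p∪q : ∀ {n} {p q : Subset n} {x : Fin n} → x ∈ p → q ∪ ⁅ x ⁆ ⊆ p ∪ q
q∪⁅x⁆⊆p∪q {p = p} {q} {x} x∈p {y} y∈q∪⁅x⁆ with x∈p∪q⁻ q ⁅ x ⁆ y∈q∪⁅x⁆
... | inj₁ y∈q   = x∈p∪q⁺ (inj₂ y∈q)
... | inj₂ y∈⁅x⁆ = x∈p∪q⁺ (inj₁ (subst (_∈ p) (sym (x∈⁅y⁆⇒x≡y x y∈⁅x⁆)) x∈p))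

p∪q∪∁[q∪⁅x⁆]≡⊤ : ∀ {n} {p q : Subset n} {x : Fin n} → x ∈ p → p ∪ q ∪ ∁ (q ∪ ⁅ x ⁆) ≡ ⊤
p∪q∪∁[q∪⁅x⁆]≡⊤ {p = p} {q} {x} x∈p = begin
  p ∪ q ∪ ∁ (q ∪ ⁅ x ⁆)    ≡⟨ ∪-assoc p q _ ⟨
  (p ∪ q) ∪ ∁ (q ∪ ⁅ x ⁆)  ≡⟨ p∪∁q≡⊤ (q∪⁅x⁆⊆p∪q x∈p) ⟩
  ⊤                        ∎
  where open ≡-Reasoning

q∪∁[q∪⁅x⁆]∪p≡⊤ : ∀ {n} {p q : Subset n} {x : Fin n} → x ∈ p → q ∪ ∁ (q ∪ ⁅ x ⁆) ∪ p ≡ ⊤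
q∪∁[q∪⁅x⁆]∪p≡⊤ {p = p} {q} {x} x∈p = begin
  q ∪ ∁ (q ∪ ⁅ x ⁆) ∪ p    ≡⟨ ∪-comm q _ ⟩
  (∁ (q ∪ ⁅ x ⁆) ∪ p) ∪ q  ≡⟨ ∪-assoc _ p q ⟩
  ∁ (q ∪ ⁅ x ⁆) ∪ p ∪ q    ≡⟨ ∪-comm _ (p ∪ q) ⟩
  (p ∪ q) ∪ ∁ (q ∪ ⁅ x ⁆)  ≡⟨ p∪∁q≡⊤ (q∪⁅x⁆⊆p∪q x∈p) ⟩
  ⊤                        ∎
  where open ≡-Reasoning

-- N[v₂] and N[v₃] in P4 compute to explicit lists, so Satisfied unfolds to a
-- union of three colour classes followed by ∪ ⊥.
module _ (g : Fin 4 → Pair5) where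

  private
    col : Fin 4 → Subset 5
    col = proj₁ ∘ g

  satisfied-v₂ : col zero ∪ col (suc zero) ∪ col (suc (suc zero)) ≡ ⊤ →
                 Satisfied P4 g (suc zero)
  satisfied-v₂ = subst (_≡ ⊤)
    (cong (λ r → col zero ∪ col (suc zero) ∪ r) (sym (∪-identityʳ _)))

  satisfied-v₃ : col (suc zero) ∪ col (suc (suc zero)) ∪ col (suc (suc (suc zero))) ≡ ⊤ →
                 Satisfied P4 g (suc (suc zero))
  satisfied-v₃ = subst (_≡ ⊤)
    (cong (λ r → col (suc zero) ∪ col (suc (suc zero)) ∪ r) (sym (∪-identityʳ _)))

lemma2p1 : (f₁ f₄ : Pair5) → Nonempty (proj₁ f₁ ∩ proj₁ f₄) →
    (a b : Fin 5) → a ≢ b → a ∉ proj₁ f₁ → b ∉ proj₁ f₁ →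
    Σ (Fin 4 → Pair5) λ g →
      (g zero ≡ f₁) × (g (suc (suc (suc zero))) ≡ f₄) ×
      Satisfied P4 g (suc zero) × Satisfied P4 g (suc (suc zero)) ×
      (proj₁ (g (suc zero)) ≡ ⁅ a ⁆ ∪ ⁅ b ⁆)
lemma2p1 f₁@(s₁ , _) f₄@(s₄ , _) (c , c∈s₁∩s₄) a b a≢b a∉s₁ b∉s₁ =
  g , refl , refl ,
  satisfied-v₂ g (p∪q∪∁[q∪⁅x⁆]≡⊤ c∈s₁) ,
  satisfied-v₃ g (q∪∁[q∪⁅x⁆]∪p≡⊤ c∈s₄) ,
  refl
  where
  c∈s₁ : c ∈ s₁
  c∈s₁ = proj₁ (x∈p∩q⁻ s₁ s₄ c∈s₁∩s₄)
  c∈s₄ : c ∈ s₄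
  c∈s₄ = proj₂ (x∈p∩q⁻ s₁ s₄ c∈s₁∩s₄)

  A : Subset 5
  A = ⁅ a ⁆ ∪ ⁅ b ⁆

  ∣∁[A∪⁅c⁆]∣≡2 : ∣ ∁ (A ∪ ⁅ c ⁆) ∣ ≡ 2
  ∣∁[A∪⁅c⁆]∣≡2 = trans (∣∁p∣≡n∸∣p∣ (A ∪ ⁅ c ⁆))
    (cong (5 ∸_) (trans (∣p∪⁅x⁆∣≡1+∣p∣ (x∈p⇒x∉⁅y⁆∪⁅z⁆ c∈s₁ a∉s₁ b∉s₁)) (cong suc (∣⁅x⁆∪⁅y⁆∣≡2 a≢b))))

  g : Fin 4 → Pair5
  g zero                   = f₁
  g (suc zero)             = A , ∣⁅x⁆∪⁅y⁆∣≡2 a≢b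
  g (suc (suc zero))       = ∁ (A ∪ ⁅ c ⁆) , ∣∁[A∪⁅c⁆]∣≡2
  g (suc (suc (suc zero))) = f₄
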